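{- Let $x\in\mathcal S$ with $x\ne x^{\max}$, let $w\in W$, and let $(c,a)$ and $(c',a')$ be disjoint essential $w$-pairs under $x$. Let $z:=x_w+\mathbf 1^a-\mathbf 1^c$ and $z':=x_w+\mathbf 1^{a'}-\mathbf 1^{c'}$. Then: (i) the vectors $z+\mathbf 1^{a'}-\mathbf 1^{c'}$ and $z'+\mathbf 1^a-\mathbf 1^c$ are acceptable for $w$; (ii) no edge $d\in U_F^+(x)$ is interesting for $w$ under $y:=x_w+\mathbf 1^a-\mathbf 1^c+\mathbf 1^{a'}-\mathbf 1^{c'}$; and (iii) the pair $(c',a')$ is essential under $z$, and $(c,a)$ is essential under $z'$.
   Context: Model. $G=(V,E)$ is a finite bipartite graph without multiple edges with color classes $W$ and $F$; an edge joining $w\in W$, $f\in F$ is written $wf$. Capacities $b\in\mathbb Z_+^E$. For $v\in V$, $E_v$ is the set of edges at $v$, $\mathcal B_v=\{z\in\mathbb Z_+^{E_v}:z\le b|_{E_v}\}$, $\mathcal B=\{x\in\mathbb Z_+^E:x\le b\}$, $x_v$ the restriction of $x$ to $E_v$. Vector inequalities componentwise, $\wedge,\vee$ componentwise min/max, $|z|=\sum_e|z(e)|$, $\mathbf 1^e$ unit vector of $e$. Each $v$ has a choice function $C_v:\mathcal B_v\to\mathcal B_v$, $C_v(z)\le z$, with: (A1) $z\ge z'\ge C_v(z)\Rightarrow C_v(z')=C_v(z)$; (A2) $z\ge z'\Rightarrow C_v(z)\wedge z'\le C_v(z')$; (A3) $z\ge z'\Rightarrow|C_v(z)|\ge|C_v(z')|$.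 $z$ is acceptable if $C_v(z)=z$; for distinct acceptable $z,z'$, $z'\prec_v z$ iff $C_v(z\vee z')=z$. $e\in E_v$ is interesting for $v$ under acceptable $z$ if some $z'\in\mathcal B_v$ agrees with $z$ off $e$, has $z'(e)>z(e)$ and $C_v(z')(e)>z(e)$. A g-matching is $x\in\mathcal B$ with all $x_v$ acceptable; $wf$ blocks $x$ if interesting for $w$ under $x_w$ and for $f$ under $x_f$; stable = no blocking edge; $\mathcal S$ = stable g-matchings; $(\mathcal S,\prec_F)$, where $x\prec_F y$ for distinct $x,y$ iff $x_f\preceq_f y_f$ for all $f\in F$, is a finite distributive lattice with greatest element $x^{\max}$. For $x\in\mathcal S$: $U_F^+(x)$ is the set of edges $wf$ interesting for $f$ under $x_f$; $U_F^-(x)$ is the set of edges $wf$ with $x(wf)>0$ not interesting for $f$ under $x_f$. For $w\in W$ and an acceptable vector $u\in\mathcal B_w$ (e.g. $u=x_w$), a pair $(c,a)$ of edges of $E_w$ with $c\in U_F^-(x)$, $a\in U_F^+(x)$ is a legal $w$-pair under $u$ if $u+\mathbf 1^a-\mathbf 1^c$ is acceptable for $w$, and it is essential under $u$ if moreover no $d\in(U_F^+(x)\cap E_w)\setminus\{a\}$ is interesting for $w$ under $u+\mathbf 1^a-\mathbf 1^c$. "Under $x$" means under $u=x_w$. Two pairs are disjoint if they share no edge. -}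

module Defs where

open import Data.Nat as ℕ using (ℕ; _≤_; _<_; _⊔_; _⊓_)
open import Data.Integer as ℤ using (ℤ; +_)
open import Data.Fin using (Fin; _≟_)
open import Data.Vec using (Vec; lookup; tabulate; map; zipWith; sum)
open import Data.Sum using (_⊎_; inj₁; inj₂)
open import Data.Product using (Σ; Σ-syntax; _×_)
open import Relation.Nullary using (¬_; does)
open import Relation.Binary.PropositionalEquality using (_≡_; _≢_)
open import Data.Bool using (if_then_else_)

-- Vectors in Z_+^E are represented as Vec ℕ m (edges are Fin m).
-- A vector in Z_+^{E_v} is represented as a Vec ℕ m vanishing outside E_v.

_≤v_ : ∀ {m} → Vec ℕ m → Vec ℕ m → Set
z ≤v z' = ∀ e → lookup z e ≤ lookup z' e

_∧v_ : ∀ {m} → Vec ℕ m → Vec ℕ m → Vec ℕ m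
_∧v_ = zipWith _⊓_

_∨v_ : ∀ {m} → Vec ℕ m → Vec ℕ m → Vec ℕ m
_∨v_ = zipWith _⊔_

∣_∣v : ∀ {m} → Vec ℕ m → ℕ
∣ z ∣v = sum z

-- Bipartite graph with color classes W = Fin nW, F = Fin nF and edge set
-- E = Fin m; edge e joins wOf e ∈ W and fOf e ∈ F; no multiple edges.
record Graph : Set where
  field
    nW nF m : ℕ
    wOf : Fin m → Fin nW
    fOf : Fin m → Fin nF
    simple : ∀ e e' → wOf e ≡ wOf e' → fOf e ≡ fOf e' → e ≡ e'

  Vertex : Set
  Vertex = Fin nW ⊎ Fin nF

  At : Vertex → Fin m → Set
  At (inj₁ w) e = wOf e ≡ w
  At (inj₂ f) e = fOf e ≡ f

  atᵇ : Vertex → Fin m → Data.Bool.Bool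
  atᵇ (inj₁ w) e = does (wOf e ≟ w)
  atᵇ (inj₂ f) e = does (fOf e ≟ f)

  restrict : Vertex → Vec ℕ m → Vec ℕ m
  restrict v x = tabulate (λ e → if atᵇ v e then lookup x e else 0)

record Market : Set where
  field
    graph : Graph
  open Graph graph public
  field
    b : Vec ℕ m
    C : Vertex → Vec ℕ m → Vec ℕ m

  InB : Vertex → Vec ℕ m → Set
  InB v z = (∀ e → ¬ At v e → lookup z e ≡ 0) × (z ≤v b)

  field
    C-dom : ∀ v z → InB v z → InB v (C v z)
    C-le  : ∀ v z → InB v z → C v z ≤v z
    A1 : ∀ v z z' → InB v z → InB v z' → z' ≤v z → C v z ≤v z' → C v z' ≡ C v z
    A2 : ∀ v z z' → InB v z → InB v z' → z' ≤v z → (C v z ∧v z') ≤v C v z'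
    A3 : ∀ v z z' → InB v z → InB v z' → z' ≤v z → ∣ C v z' ∣v ≤ ∣ C v z ∣v

module _ (M : Market) where
  open Market M

  Acceptable : Vertex → Vec ℕ m → Set
  Acceptable v z = InB v z × (C v z ≡ z)

  Interesting : Vertex → Vec ℕ m → Fin m → Set
  Interesting v z e =
    At v e × Σ[ z' ∈ Vec ℕ m ]
      (InB v z' × (∀ e' → e' ≢ e → lookup z' e' ≡ lookup z e')
               × (lookup z e < lookup z' e) × (lookup z e < lookup (C v z') e))

  GMatching : Vec ℕ m → Set
  GMatching x = (x ≤v b) × (∀ v → Acceptable v (restrict v x))

  Blocks : Vec ℕ m → Fin m → Set
  Blocks x e = Interesting (inj₁ (wOf e)) (restrict (inj₁ (wOf e)) x) e
             × Interesting (inj₂ (fOf e)) (restrict (inj₂ (fOf e)) x) e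

  Stable : Vec ℕ m → Set
  Stable x = GMatching x × (∀ e → ¬ Blocks x e)

  PrefEq : Vertex → Vec ℕ m → Vec ℕ m → Set
  PrefEq v z' z = (z' ≡ z) ⊎ ((z' ≢ z) × (C v (z ∨v z') ≡ z))

  PrefEqF : Vec ℕ m → Vec ℕ m → Set
  PrefEqF x y = (x ≡ y) ⊎ ((x ≢ y) × (∀ f → PrefEq (inj₂ f) (restrict (inj₂ f) x) (restrict (inj₂ f) y)))

  IsGreatest : Vec ℕ m → Set
  IsGreatest xmax = Stable xmax × (∀ y → Stable y → PrefEqF y xmax)

  UF⁺ : Vec ℕ m → Fin m → Set
  UF⁺ x e = Interesting (inj₂ (fOf e)) (restrict (inj₂ (fOf e)) x) e

  UF⁻ : Vec ℕ m → Fin m → Set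
  UF⁻ x e = (0 < lookup x e) × ¬ UF⁺ x e

  -- Integer vectors, used to form u + 1^a - 1^c exactly.
  emb : Vec ℕ m → Vec ℤ m
  emb = map +_

  δ : Fin m → Fin m → ℤ
  δ a e = if does (a ≟ e) then + 1 else + 0

  shift : Vec ℤ m → Fin m → Fin m → Vec ℤ m
  shift u a c = tabulate (λ e → lookup u e ℤ.+ δ a e ℤ.- δ c e)

  AcceptableZ : Vertex → Vec ℤ m → Set
  AcceptableZ v u = Σ[ z ∈ Vec ℕ m ] (emb z ≡ u × Acceptable v z)

  InterestingZ : Vertex → Vec ℤ m → Fin m → Set
  InterestingZ v u e = Σ[ z ∈ Vec ℕ m ] (emb z ≡ u × Interesting v z e)

  Legal : Vec ℕ m → Fin nW → Vec ℤ m → Fin m → Fin m → Set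
  Legal x w u c a = At (inj₁ w) c × At (inj₁ w) a × UF⁻ x c × UF⁺ x a
                  × AcceptableZ (inj₁ w) (shift u a c)

  Essential : Vec ℕ m → Fin nW → Vec ℤ m → Fin m → Fin m → Set
  Essential x w u c a = Legal x w u c a
    × (∀ d → UF⁺ x d → At (inj₁ w) d → d ≢ a → ¬ InterestingZ (inj₁ w) (shift u a c) d)

  DisjointPairs : Fin m → Fin m → Fin m → Fin m → Set
  DisjointPairs c a c' a' = (c ≢ c') × (c ≢ a') × (a ≢ c') × (a ≢ a')

-- Let Z = x_w + 1^a - 1^c, Z' = x_w + 1^a' - 1^c' and Y = Z + 1^a' - 1^c' = Z' + 1^a - 1^c.
-- As a' is not interesting under Z, (A1) and (A2) give C(Z + 1^a') = Z, and likewise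
-- C(Z' + 1^a) = Z'. In every coordinate Y lies below Z or below Z', and Y is below both raised
-- vectors, so (A2) yields Y ≤ C(Y): Y is acceptable. If some d ∈ U_F^+(x) were interesting under
-- Y via a vector D, then adding back the unit removed at c' (or at c) to D gives a vector whose
-- choice is again Z (or Z'); by (A2) Y ≤ C(D) off d, strictly at d, while (A3) bounds ∣C(D)∣ by
-- ∣Z∣ = ∣Y∣, a contradiction. Part (iii) is (i) and (ii) read under z and z'.

module Submission where

open import Defs
open import Data.Nat using (ℕ; suc; pred; _≤_; _<_; _+_; _⊓_; >-nonZero)
open import Data.Nat.Properties
  using (≤-refl; ≤-trans; ≤-antisym; <⇒≤; ≤-<-trans; ≮⇒≥; <⇒≱; n≤1+n; pred[n]≤n;
         +-mono-≤; +-suc; ≤-reflexive; n<1+n; +-identityʳ; +-comm; suc-injective; suc-pred;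
         m≤n⇒m⊓n≡m; m≥n⇒m⊓n≡n; n≤0⇒n≡0; module ≤-Reasoning)
import Data.Integer as ℤ
import Data.Integer.Properties as ℤP
open import Data.Fin using (Fin; zero; _≟_)
  renaming (suc to fsuc)
open import Data.Vec using (Vec; []; _∷_; lookup; sum; _[_]%=_; _[_]≔_)
open import Data.Vec.Properties
  using (lookup∘updateAt; lookup∘updateAt′; updateAt-commutes; updateAt-updateAt-local;
         updateAt-id-local; lookup-map; lookup∘tabulate; lookup-zipWith)
open import Data.Vec.Relation.Binary.Pointwise.Extensional using (ext; Pointwise-≡⇒≡)
open import Data.Product using (_×_; _,_; proj₁)
open import Data.Sum using (_⊎_; inj₁; inj₂)
open import Data.Empty using (⊥-elim)
open import Data.Bool using (true; if_then_else_)
open import Function using (_∘_)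
open import Relation.Nullary using (¬_; yes; no)
open import Relation.Nullary.Decidable using (dec-true)
open import Relation.Binary.PropositionalEquality

private variable n : ℕ

EqualOff : Fin n → Vec ℕ n → Vec ℕ n → Set
EqualOff d P Q = ∀ e → e ≢ d → lookup P e ≡ lookup Q e

-- shiftℕ P a c = P + 1^a - 1^c, exact when a ≢ c and P c > 0.
shiftℕ : Vec ℕ n → Fin n → Fin n → Vec ℕ n
shiftℕ P a c = P [ a ]%= suc [ c ]%= pred

≤v-[]%= : ∀ {f : ℕ → ℕ} (P : Vec ℕ n) i → (∀ k → k ≤ f k) → P ≤v (P [ i ]%= f)
≤v-[]%= P i f-inflationary e with e ≟ i
... | yes refl = subst (lookup P e ≤_) (sym (lookup∘updateAt e P)) (f-inflationary _)
... | no e≢i = ≤-reflexive (sym (lookup∘updateAt′ e i e≢i P))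

[]%=-≤v : ∀ {f : ℕ → ℕ} (P : Vec ℕ n) i → (∀ k → f k ≤ k) → (P [ i ]%= f) ≤v P
[]%=-≤v P i f-deflationary e with e ≟ i
... | yes refl = subst (_≤ lookup P e) (sym (lookup∘updateAt e P)) (f-deflationary _)
... | no e≢i = ≤-reflexive (lookup∘updateAt′ e i e≢i P)

EqualOff-[]%= : ∀ {f : ℕ → ℕ} (P Q : Vec ℕ n) d j →
                EqualOff d P Q → EqualOff d (P [ j ]%= f) (Q [ j ]%= f)
EqualOff-[]%= {f = f} P Q d j P≈Q e e≢d with e ≟ j
... | yes refl = trans (lookup∘updateAt e P) (trans (cong f (P≈Q e e≢d)) (sym (lookup∘updateAt e Q)))
... | no e≢j = trans (lookup∘updateAt′ e j e≢j P) (trans (P≈Q e e≢d) (sym (lookup∘updateAt′ e j e≢j Q)))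

lookup-shiftℕ-added : ∀ (P : Vec ℕ n) {a c} → a ≢ c → lookup (shiftℕ P a c) a ≡ suc (lookup P a)
lookup-shiftℕ-added P {a} {c} a≢c =
  trans (lookup∘updateAt′ a c {pred} a≢c (P [ a ]%= suc)) (lookup∘updateAt a {suc} P)

lookup-shiftℕ-removed : ∀ (P : Vec ℕ n) {a c} → a ≢ c → lookup (shiftℕ P a c) c ≡ pred (lookup P c)
lookup-shiftℕ-removed P {a} {c} a≢c =
  trans (lookup∘updateAt c {pred} (P [ a ]%= suc)) (cong pred (lookup∘updateAt′ c a {suc} (≢-sym a≢c) P))

lookup-shiftℕ-other : ∀ (P : Vec ℕ n) {a c e} → e ≢ a → e ≢ c → lookup (shiftℕ P a c) e ≡ lookup P e
lookup-shiftℕ-other P {a} {c} {e} e≢a e≢c =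
  trans (lookup∘updateAt′ e c {pred} e≢c (P [ a ]%= suc)) (lookup∘updateAt′ e a {suc} e≢a P)

shiftℕ-≤v : ∀ (P : Vec ℕ n) a c → shiftℕ P a c ≤v (P [ a ]%= suc)
shiftℕ-≤v P a c = []%=-≤v (P [ a ]%= suc) c (λ _ → pred[n]≤n)

shiftℕ-≤-off : ∀ (P : Vec ℕ n) {a c e} → e ≢ a → lookup (shiftℕ P a c) e ≤ lookup P e
shiftℕ-≤-off P {a} {c} {e} e≢a =
  subst (lookup (shiftℕ P a c) e ≤_) (lookup∘updateAt′ e a {suc} e≢a P) (shiftℕ-≤v P a c e)

shiftℕ-[]%=suc : ∀ (P : Vec ℕ n) {a c} → a ≢ c → 0 < lookup P c → shiftℕ P a c [ c ]%= suc ≡ P [ a ]%= suc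
shiftℕ-[]%=suc P {a} {c} a≢c 0<Pc =
  trans (updateAt-updateAt-local c {suc} {pred} {λ k → k} (P [ a ]%= suc) (suc-pred _ {{>-nonZero 0<Qc}}))
        (updateAt-id-local c {λ k → k} (P [ a ]%= suc) refl)
  where
  0<Qc : 0 < lookup (P [ a ]%= suc) c
  0<Qc = subst (0 <_) (sym (lookup∘updateAt′ c a {suc} (≢-sym a≢c) P)) 0<Pc

shiftℕ-comm : ∀ (P : Vec ℕ n) {a c a' c'} → a ≢ a' → a ≢ c' → c ≢ a' → c ≢ c' →
              shiftℕ (shiftℕ P a c) a' c' ≡ shiftℕ (shiftℕ P a' c') a c
shiftℕ-comm P {a} {c} {a'} {c'} a≢a' a≢c' c≢a' c≢c' = begin
  P [ a ]%= suc [ c ]%= pred [ a' ]%= suc [ c' ]%= pred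
    ≡⟨ cong (_[ c' ]%= pred) (updateAt-commutes a' c (≢-sym c≢a') _) ⟩
  P [ a ]%= suc [ a' ]%= suc [ c ]%= pred [ c' ]%= pred
    ≡⟨ cong (λ Q → Q [ c ]%= pred [ c' ]%= pred) (updateAt-commutes a' a (≢-sym a≢a') P) ⟩
  P [ a' ]%= suc [ a ]%= suc [ c ]%= pred [ c' ]%= pred
    ≡⟨ updateAt-commutes c' c (≢-sym c≢c') _ ⟩
  P [ a' ]%= suc [ a ]%= suc [ c' ]%= pred [ c ]%= pred
    ≡⟨ cong (_[ c ]%= pred) (updateAt-commutes c' a (≢-sym a≢c') _) ⟩
  P [ a' ]%= suc [ c' ]%= pred [ a ]%= suc [ c ]%= pred ∎
  where open ≡-Reasoning

sum-[]%=suc : ∀ (P : Vec ℕ n) i → sum (P [ i ]%= suc) ≡ suc (sum P)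
sum-[]%=suc (p ∷ P) zero = refl
sum-[]%=suc (p ∷ P) (fsuc i) = trans (cong (p +_) (sum-[]%=suc P i)) (+-suc p (sum P))

sum-[]%=pred : ∀ (P : Vec ℕ n) i → 0 < lookup P i → suc (sum (P [ i ]%= pred)) ≡ sum P
sum-[]%=pred (suc p ∷ P) zero _ = refl
sum-[]%=pred (p ∷ P) (fsuc i) 0<Pi = trans (sym (+-suc p _)) (cong (p +_) (sum-[]%=pred P i 0<Pi))

sum-shiftℕ : ∀ (P : Vec ℕ n) {a c} → a ≢ c → 0 < lookup P c → sum (shiftℕ P a c) ≡ sum P
sum-shiftℕ P {a} {c} a≢c 0<Pc = suc-injective (begin
  suc (sum (shiftℕ P a c))  ≡⟨ sum-[]%=pred (P [ a ]%= suc) c 0<Qc ⟩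
  sum (P [ a ]%= suc)       ≡⟨ sum-[]%=suc P a ⟩
  suc (sum P)               ∎)
  where
  open ≡-Reasoning
  0<Qc : 0 < lookup (P [ a ]%= suc) c
  0<Qc = subst (0 <_) (sym (lookup∘updateAt′ c a {suc} (≢-sym a≢c) P)) 0<Pc

sum-mono-≤ : ∀ (P Q : Vec ℕ n) → P ≤v Q → sum P ≤ sum Q
sum-mono-≤ [] [] _ = ≤-refl
sum-mono-≤ (p ∷ P) (q ∷ Q) P≤Q = +-mono-≤ (P≤Q zero) (sum-mono-≤ P Q (P≤Q ∘ fsuc))

sum-mono-< : ∀ (P Q : Vec ℕ n) d → (∀ e → e ≢ d → lookup P e ≤ lookup Q e) →
             lookup P d < lookup Q d → sum P < sum Q
sum-mono-< P Q d P≤Q-off Pd<Qd = subst (_≤ sum Q) (sum-[]%=suc P d) (sum-mono-≤ (P [ d ]%= suc) Q P+d≤Q)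
  where
  P+d≤Q : (P [ d ]%= suc) ≤v Q
  P+d≤Q e with e ≟ d
  ... | yes refl = subst (_≤ lookup Q e) (sym (lookup∘updateAt e P)) Pd<Qd
  ... | no e≢d = subst (_≤ lookup Q e) (sym (lookup∘updateAt′ e d e≢d P)) (P≤Q-off e e≢d)

module _ (M : Market) where
  open Market M

  emb-injective : ∀ {P Q : Vec ℕ m} → emb M P ≡ emb M Q → P ≡ Q
  emb-injective {P} {Q} eq = Pointwise-≡⇒≡ (ext λ e → ℤP.+-injective (begin
    ℤ.+ lookup P e      ≡⟨ lookup-map e ℤ.+_ P ⟨
    lookup (emb M P) e  ≡⟨ cong (λ u → lookup u e) eq ⟩
    lookup (emb M Q) e  ≡⟨ lookup-map e ℤ.+_ Q ⟩
    ℤ.+ lookup Q e      ∎))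
    where open ≡-Reasoning

  emb-shiftℕ : ∀ (P : Vec ℕ m) {a c} → a ≢ c → 0 < lookup P c →
               emb M (shiftℕ P a c) ≡ shift M (emb M P) a c
  emb-shiftℕ P {a} {c} a≢c 0<Pc = Pointwise-≡⇒≡ (ext λ e → begin
    lookup (emb M (shiftℕ P a c)) e              ≡⟨ lookup-map e ℤ.+_ (shiftℕ P a c) ⟩
    ℤ.+ lookup (shiftℕ P a c) e                  ≡⟨ pointwise e ⟩
    ℤ.+ lookup P e ℤ.+ δ M a e ℤ.- δ M c e       ≡⟨ cong (λ z → z ℤ.+ δ M a e ℤ.- δ M c e) (lookup-map e ℤ.+_ P) ⟨
    lookup (emb M P) e ℤ.+ δ M a e ℤ.- δ M c e   ≡⟨ lookup∘tabulate _ e ⟨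
    lookup (shift M (emb M P) a c) e             ∎)
    where
    open ≡-Reasoning
    pointwise : ∀ e → ℤ.+ lookup (shiftℕ P a c) e ≡ ℤ.+ lookup P e ℤ.+ δ M a e ℤ.- δ M c e
    pointwise e with a ≟ e | c ≟ e
    ... | yes refl | yes refl = ⊥-elim (a≢c refl)
    ... | yes refl | no _ rewrite lookup-shiftℕ-added P a≢c | +-identityʳ (lookup P e + 1) =
      cong ℤ.+_ (+-comm 1 (lookup P e))
    ... | no _ | yes refl rewrite lookup-shiftℕ-removed P a≢c = pred-ℤ (lookup P e) 0<Pc
      where
      pred-ℤ : ∀ q → 0 < q → ℤ.+ pred q ≡ ℤ.+ q ℤ.+ ℤ.+ 0 ℤ.- ℤ.+ 1
      pred-ℤ (suc q) _ rewrite +-identityʳ q = refl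
    ... | no a≢e | no c≢e rewrite lookup-shiftℕ-other P (≢-sym a≢e) (≢-sym c≢e)
      | +-identityʳ (lookup P e) | +-identityʳ (lookup P e) = refl

  lookup-restrict : ∀ v (x : Vec ℕ m) {e} → At v e → lookup (restrict v x) e ≡ lookup x e
  lookup-restrict v x {e} e∈Ev =
    trans (lookup∘tabulate _ e) (cong (λ b → if b then lookup x e else 0) (atᵇ-true v e∈Ev))
    where
    atᵇ-true : ∀ v → At v e → atᵇ v e ≡ true
    atᵇ-true (inj₁ w) = dec-true (wOf e ≟ w)
    atᵇ-true (inj₂ f) = dec-true (fOf e ≟ f)

  module ChoiceFunction (v : Vertex) where

    InB-≤⊎≤ : ∀ {P Q T : Vec ℕ m} → (∀ e → lookup T e ≤ lookup P e ⊎ lookup T e ≤ lookup Q e) →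
              InB v P → InB v Q → InB v T
    InB-≤⊎≤ {P} {Q} {T} T≤P⊎Q (P-support , P≤b) (Q-support , Q≤b) = T-support , T≤b
      where
      T-support : ∀ e → ¬ At v e → lookup T e ≡ 0
      T-support e e∉Ev with T≤P⊎Q e
      ... | inj₁ Te≤Pe = n≤0⇒n≡0 (subst (lookup T e ≤_) (P-support e e∉Ev) Te≤Pe)
      ... | inj₂ Te≤Qe = n≤0⇒n≡0 (subst (lookup T e ≤_) (Q-support e e∉Ev) Te≤Qe)
      T≤b : T ≤v b
      T≤b e with T≤P⊎Q e
      ... | inj₁ Te≤Pe = ≤-trans Te≤Pe (P≤b e)
      ... | inj₂ Te≤Qe = ≤-trans Te≤Qe (Q≤b e)

    InB-mono : ∀ {P T : Vec ℕ m} → T ≤v P → InB v P → InB v T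
    InB-mono {P} {T} T≤P P∈B = InB-≤⊎≤ {P} {P} {T} (inj₁ ∘ T≤P) P∈B P∈B

    acceptable-if-≤-choice : ∀ {P : Vec ℕ m} → InB v P → P ≤v C v P → Acceptable M v P
    acceptable-if-≤-choice {P} P∈B P≤CP =
      P∈B , Pointwise-≡⇒≡ (ext λ e → ≤-antisym (C-le v P P∈B e) (P≤CP e))

    Uninteresting : Vec ℕ m → Fin m → Set
    Uninteresting P d = ∀ T → InB v T → EqualOff d T P → lookup P d < lookup T d →
                        lookup (C v T) d ≤ lookup P d

    ¬Interesting⇒Uninteresting : ∀ {P d} → At v d → ¬ Interesting M v P d → Uninteresting P d
    ¬Interesting⇒Uninteresting d∈Ev ¬interesting T T∈B T≈P Pd<Td =
      ≮⇒≥ λ Pd<CTd → ¬interesting (d∈Ev , T , T∈B , T≈P , Pd<Td , Pd<CTd)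

    ≤-choice-of-smaller : ∀ {P T D : Vec ℕ m} {e} → InB v T → C v T ≡ P → D ≤v T →
                          lookup D e ≤ lookup P e → lookup D e ≤ lookup (C v D) e
    ≤-choice-of-smaller {P} {T} {D} {e} T∈B CT≡P D≤T De≤Pe = begin
      lookup D e                      ≡⟨ m≥n⇒m⊓n≡n De≤Pe ⟨
      lookup P e ⊓ lookup D e         ≡⟨ cong (λ Q → lookup Q e ⊓ lookup D e) CT≡P ⟨
      lookup (C v T) e ⊓ lookup D e   ≡⟨ lookup-zipWith _⊓_ e (C v T) D ⟨
      lookup (C v T ∧v D) e           ≤⟨ A2 v T D T∈B (InB-mono {T} {D} D≤T T∈B) D≤T e ⟩
      lookup (C v D) e                ∎
      where open ≤-Reasoning

    -- Comparing T with R = P [ d ]≔ T d: uninterestingness of d bounds C T at d by (A2),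
    -- so C T ≤ Q ≤ T and (A1) gives C T = C Q.
    choice-raise : ∀ {P Q T : Vec ℕ m} {d} → InB v Q → InB v T → C v Q ≡ P →
                   EqualOff d T Q → lookup Q d < lookup T d → Uninteresting P d → C v T ≡ P
    choice-raise {P} {Q} {T} {d} Q∈B T∈B CQ≡P T≈Q Qd<Td d-uninteresting =
      trans (sym (A1 v T Q T∈B Q∈B Q≤T CT≤Q)) CQ≡P
      where
      P≤Q : P ≤v Q
      P≤Q = subst (_≤v Q) CQ≡P (C-le v Q Q∈B)
      Q≤T : Q ≤v T
      Q≤T e with e ≟ d
      ... | yes refl = <⇒≤ Qd<Td
      ... | no e≢d = ≤-reflexive (sym (T≈Q e e≢d))
      R : Vec ℕ m
      R = P [ d ]≔ lookup T d
      R≤T : R ≤v T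
      R≤T e with e ≟ d
      ... | yes refl = ≤-reflexive (lookup∘updateAt e P)
      ... | no e≢d = subst₂ _≤_ (sym (lookup∘updateAt′ e d e≢d P)) (sym (T≈Q e e≢d)) (P≤Q e)
      Rd≡Td : lookup R d ≡ lookup T d
      Rd≡Td = lookup∘updateAt d P
      CTd≤Pd : lookup (C v T) d ≤ lookup P d
      CTd≤Pd = begin
        lookup (C v T) d                ≡⟨ m≤n⇒m⊓n≡m (subst (lookup (C v T) d ≤_) (sym Rd≡Td)
                                                                  (C-le v T T∈B d)) ⟨
        lookup (C v T) d ⊓ lookup R d   ≡⟨ lookup-zipWith _⊓_ d (C v T) R ⟨
        lookup (C v T ∧v R) d           ≤⟨ A2 v T R T∈B (InB-mono {T} {R} R≤T T∈B) R≤T d ⟩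
        lookup (C v R) d                ≤⟨ d-uninteresting R (InB-mono {T} {R} R≤T T∈B)
                                             (λ e e≢d → lookup∘updateAt′ e d e≢d P)
                                             (subst (lookup P d <_) (sym Rd≡Td) (≤-<-trans (P≤Q d) Qd<Td)) ⟩
        lookup P d                      ∎
        where open ≤-Reasoning
      CT≤Q : C v T ≤v Q
      CT≤Q e with e ≟ d
      ... | yes refl = ≤-trans CTd≤Pd (P≤Q e)
      ... | no e≢d = subst (lookup (C v T) e ≤_) (T≈Q e e≢d) (C-le v T T∈B e)

    choice-[]%=suc : ∀ {P : Vec ℕ m} {d} → Acceptable M v P → InB v (P [ d ]%= suc) →
                     Uninteresting P d → C v (P [ d ]%= suc) ≡ P
    choice-[]%=suc {P} {d} (P∈B , CP≡P) P+d∈B =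
      choice-raise P∈B P+d∈B CP≡P (λ e e≢d → lookup∘updateAt′ e d e≢d P)
                   (subst (lookup P d <_) (sym (lookup∘updateAt d P)) (n<1+n _))

    -- D differs from shiftℕ P i j only at d; adding back the unit removed at j yields a vector
    -- differing from P [ i ]%= suc only at d, to which choice-raise applies.
    choice-restored : ∀ {P D : Vec ℕ m} {i j d} → InB v (P [ i ]%= suc) → C v (P [ i ]%= suc) ≡ P →
                      i ≢ j → 0 < lookup P j → Uninteresting P d → d ≢ j →
                      InB v D → EqualOff d D (shiftℕ P i j) → lookup (shiftℕ P i j) d < lookup D d →
                      InB v (D [ j ]%= suc) × C v (D [ j ]%= suc) ≡ P
    choice-restored {P} {D} {i} {j} {d} Q∈B CQ≡P i≢j 0<Pj d-uninteresting d≢j D∈B D≈Y Yd<Dd =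
      T∈B , choice-raise Q∈B T∈B CQ≡P T≈Q Qd<Td d-uninteresting
      where
      Q T : Vec ℕ m
      Q = P [ i ]%= suc
      T = D [ j ]%= suc
      T≈Q : EqualOff d T Q
      T≈Q = subst (EqualOff d T) (shiftℕ-[]%=suc P i≢j 0<Pj) (EqualOff-[]%= D (shiftℕ P i j) d j D≈Y)
      Td≡Dd : lookup T d ≡ lookup D d
      Td≡Dd = lookup∘updateAt′ d j d≢j D
      Qd<Td : lookup Q d < lookup T d
      Qd<Td = subst₂ _<_ (lookup∘updateAt′ d j d≢j Q) (sym Td≡Dd) Yd<Dd
      T∈B : InB v T
      T∈B = InB-≤⊎≤ {Q} {D} {T} T≤Q⊎D Q∈B D∈B
        where
        T≤Q⊎D : ∀ e → lookup T e ≤ lookup Q e ⊎ lookup T e ≤ lookup D e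
        T≤Q⊎D e with e ≟ d
        ... | yes refl = inj₂ (≤-reflexive Td≡Dd)
        ... | no e≢d = inj₁ (≤-reflexive (T≈Q e e≢d))

    InB-shiftℕ-[]%=suc : ∀ (X : Vec ℕ m) {a c a' c'} → a' ≢ a → a' ≢ c → a' ≢ c' →
                         InB v (shiftℕ X a c) → InB v (shiftℕ X a' c') → InB v (shiftℕ X a c [ a' ]%= suc)
    InB-shiftℕ-[]%=suc X {a} {c} {a'} {c'} a'≢a a'≢c a'≢c' Z∈B Z'∈B =
      InB-≤⊎≤ {Z} {Z'} {Z [ a' ]%= suc} bound Z∈B Z'∈B
      where
      Z Z' : Vec ℕ m
      Z = shiftℕ X a c
      Z' = shiftℕ X a' c'
      bound : ∀ e → lookup (Z [ a' ]%= suc) e ≤ lookup Z e ⊎ lookup (Z [ a' ]%= suc) e ≤ lookup Z' e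
      bound e with e ≟ a'
      ... | yes refl = inj₂ (≤-reflexive (begin
        lookup (Z [ e ]%= suc) e  ≡⟨ lookup∘updateAt e Z ⟩
        suc (lookup Z e)          ≡⟨ cong suc (lookup-shiftℕ-other X a'≢a a'≢c) ⟩
        suc (lookup X e)          ≡⟨ lookup-shiftℕ-added X a'≢c' ⟨
        lookup Z' e               ∎))
        where open ≡-Reasoning
      ... | no e≢a' = inj₁ (≤-reflexive (lookup∘updateAt′ e a' e≢a' Z))

  module TwoExchanges (v : Vertex) {X : Vec ℕ m} {a c a' c' : Fin m}
    (a≢c : a ≢ c) (a'≢c' : a' ≢ c') (c≢c' : c ≢ c') (c≢a' : c ≢ a') (a≢c' : a ≢ c') (a≢a' : a ≢ a')
    (0<Xc : 0 < lookup X c) (0<Xc' : 0 < lookup X c')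
    (Z-acceptable : Acceptable M v (shiftℕ X a c)) (Z'-acceptable : Acceptable M v (shiftℕ X a' c'))
    (a'-uninteresting : ChoiceFunction.Uninteresting v (shiftℕ X a c) a')
    (a-uninteresting : ChoiceFunction.Uninteresting v (shiftℕ X a' c') a)
    where
    open ChoiceFunction v

    Z Z' Y : Vec ℕ m
    Z = shiftℕ X a c
    Z' = shiftℕ X a' c'
    Y = shiftℕ Z a' c'

    Y≡shiftℕ-Z' : Y ≡ shiftℕ Z' a c
    Y≡shiftℕ-Z' = shiftℕ-comm X a≢a' a≢c' c≢a' c≢c'

    0<Zc' : 0 < lookup Z c'
    0<Zc' = subst (0 <_) (sym (lookup-shiftℕ-other X (≢-sym a≢c') (≢-sym c≢c'))) 0<Xc'

    0<Z'c : 0 < lookup Z' c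
    0<Z'c = subst (0 <_) (sym (lookup-shiftℕ-other X c≢a' c≢c')) 0<Xc

    Z+a'∈B : InB v (Z [ a' ]%= suc)
    Z+a'∈B = InB-shiftℕ-[]%=suc X (≢-sym a≢a') (≢-sym c≢a') a'≢c' (proj₁ Z-acceptable) (proj₁ Z'-acceptable)

    Z'+a∈B : InB v (Z' [ a ]%= suc)
    Z'+a∈B = InB-shiftℕ-[]%=suc X a≢a' a≢c' a≢c (proj₁ Z'-acceptable) (proj₁ Z-acceptable)

    C-Z+a' : C v (Z [ a' ]%= suc) ≡ Z
    C-Z+a' = choice-[]%=suc Z-acceptable Z+a'∈B a'-uninteresting

    C-Z'+a : C v (Z' [ a ]%= suc) ≡ Z'
    C-Z'+a = choice-[]%=suc Z'-acceptable Z'+a∈B a-uninteresting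

    Y≤Z'+a : Y ≤v (Z' [ a ]%= suc)
    Y≤Z'+a = subst (_≤v (Z' [ a ]%= suc)) (sym Y≡shiftℕ-Z') (shiftℕ-≤v Z' a c)

    Y-≤-Z'-off : ∀ {e} → e ≢ a → lookup Y e ≤ lookup Z' e
    Y-≤-Z'-off {e} e≢a = subst (λ W → lookup W e ≤ lookup Z' e) (sym Y≡shiftℕ-Z') (shiftℕ-≤-off Z' e≢a)

    emb-Y : emb M Y ≡ shift M (emb M Z) a' c'
    emb-Y = emb-shiftℕ Z a'≢c' 0<Zc'

    emb-Y' : emb M Y ≡ shift M (emb M Z') a c
    emb-Y' = trans (cong (emb M) Y≡shiftℕ-Z') (emb-shiftℕ Z' a≢c 0<Z'c)

    Y-acceptable : Acceptable M v Y
    Y-acceptable = acceptable-if-≤-choice Y∈B Y≤CY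
      where
      Y∈B : InB v Y
      Y∈B = InB-mono {Z [ a' ]%= suc} {Y} (shiftℕ-≤v Z a' c') Z+a'∈B
      Y≤CY : Y ≤v C v Y
      Y≤CY e with e ≟ a'
      ... | yes refl = ≤-choice-of-smaller Z'+a∈B C-Z'+a Y≤Z'+a (Y-≤-Z'-off (≢-sym a≢a'))
      ... | no e≢a' = ≤-choice-of-smaller Z+a'∈B C-Z+a' (shiftℕ-≤v Z a' c') (shiftℕ-≤-off Z e≢a')

    ¬Interesting-Y : ∀ {d} → d ≢ c → d ≢ c' →
                     (d ≢ a → Uninteresting Z d) → (d ≢ a' → Uninteresting Z' d) → ¬ Interesting M v Y d
    ¬Interesting-Y {d} d≢c d≢c' Z-uninteresting Z'-uninteresting (_ , D , D∈B , D≈Y , Yd<Dd , Yd<CDd) =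
      <⇒≱ (sum-mono-< Y (C v D) d Y≤CD-off Yd<CDd) ∣CD∣≤∣Y∣
      where
      via-Z : d ≢ a → InB v (D [ c' ]%= suc) × C v (D [ c' ]%= suc) ≡ Z
      via-Z d≢a = choice-restored Z+a'∈B C-Z+a' a'≢c' 0<Zc' (Z-uninteresting d≢a) d≢c' D∈B D≈Y Yd<Dd
      via-Z' : d ≢ a' → InB v (D [ c ]%= suc) × C v (D [ c ]%= suc) ≡ Z'
      via-Z' d≢a' = choice-restored Z'+a∈B C-Z'+a a≢c 0<Z'c (Z'-uninteresting d≢a') d≢c D∈B
                      (subst (EqualOff d D) Y≡shiftℕ-Z' D≈Y)
                      (subst (λ W → lookup W d < lookup D d) Y≡shiftℕ-Z' Yd<Dd)
      bound-via : ∀ {P j} → InB v (D [ j ]%= suc) × C v (D [ j ]%= suc) ≡ P →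
                  ∀ {e} → e ≢ d → lookup Y e ≤ lookup P e → lookup Y e ≤ lookup (C v D) e
      bound-via {P} {j} (T∈B , CT≡P) {e} e≢d Ye≤Pe =
        subst (_≤ lookup (C v D) e) (D≈Y e e≢d)
          (≤-choice-of-smaller T∈B CT≡P (≤v-[]%= D j n≤1+n) (subst (_≤ lookup P e) (sym (D≈Y e e≢d)) Ye≤Pe))
      Y≤CD-off : ∀ e → e ≢ d → lookup Y e ≤ lookup (C v D) e
      Y≤CD-off e e≢d with e ≟ a' | d ≟ a
      ... | no e≢a' | no d≢a = bound-via (via-Z d≢a) e≢d (shiftℕ-≤-off Z e≢a')
      ... | yes refl | _ = bound-via (via-Z' (≢-sym e≢d)) e≢d (Y-≤-Z'-off (≢-sym a≢a'))
      ... | no _ | yes refl = bound-via (via-Z' a≢a') e≢d (Y-≤-Z'-off e≢d)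
      ∣CD∣-bound : ∀ {P j} → InB v (D [ j ]%= suc) × C v (D [ j ]%= suc) ≡ P →
                   sum P ≡ sum Y → sum (C v D) ≤ sum Y
      ∣CD∣-bound {P} {j} (T∈B , CT≡P) ∣P∣≡∣Y∣ =
        subst (sum (C v D) ≤_) (trans (cong sum CT≡P) ∣P∣≡∣Y∣)
          (A3 v (D [ j ]%= suc) D T∈B D∈B (≤v-[]%= D j n≤1+n))
      ∣CD∣≤∣Y∣ : sum (C v D) ≤ sum Y
      ∣CD∣≤∣Y∣ with d ≟ a
      ... | yes refl = ∣CD∣-bound (via-Z' a≢a')
                         (sym (trans (cong sum Y≡shiftℕ-Z') (sum-shiftℕ Z' a≢c 0<Z'c)))
      ... | no d≢a = ∣CD∣-bound (via-Z d≢a) (sym (sum-shiftℕ Z a'≢c' 0<Zc'))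

  module _ (x : Vec ℕ m) (w : Fin nW) where
    private
      v : Vertex
      v = inj₁ w
      X : Vec ℕ m
      X = restrict v x
    open ChoiceFunction v

    UF⁺-UF⁻-disjoint : ∀ {d e} → UF⁺ M x d → UF⁻ M x e → d ≢ e
    UF⁺-UF⁻-disjoint d∈U⁺ (_ , e∉U⁺) refl = e∉U⁺ d∈U⁺

    0<restrict : ∀ {c} → At v c → UF⁻ M x c → 0 < lookup X c
    0<restrict c∈Ew (0<xc , _) = subst (0 <_) (sym (lookup-restrict v x c∈Ew)) 0<xc

    emb-shiftℕ-restrict : ∀ {c a} → At v c → UF⁻ M x c → UF⁺ M x a →
                          emb M (shiftℕ X a c) ≡ shift M (emb M X) a c
    emb-shiftℕ-restrict c∈Ew c∈U⁻ a∈U⁺ =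
      emb-shiftℕ X (UF⁺-UF⁻-disjoint a∈U⁺ c∈U⁻) (0<restrict c∈Ew c∈U⁻)

    -- An essential w-pair (c , a) under x_w, with x_w + 1^a - 1^c computed in ℕ.
    record EssentialExchange (c a : Fin m) : Set where
      field
        c∈Ew : At v c
        a∈Ew : At v a
        c∈U⁻ : UF⁻ M x c
        a∈U⁺ : UF⁺ M x a
        acceptable : Acceptable M v (shiftℕ X a c)
        others-uninteresting : ∀ d → UF⁺ M x d → At v d → d ≢ a → Uninteresting (shiftℕ X a c) d

    essential-exchange : ∀ {c a} → Essential M x w (emb M X) c a → EssentialExchange c a
    essential-exchange {c} {a} ((c∈Ew , a∈Ew , c∈U⁻ , a∈U⁺ , (Z , Z≡ , Z-acceptable)) , no-interesting) =
      record
      { c∈Ew = c∈Ew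
      ; a∈Ew = a∈Ew
      ; c∈U⁻ = c∈U⁻
      ; a∈U⁺ = a∈U⁺
      ; acceptable = subst (Acceptable M v) (emb-injective (trans Z≡ (sym embedding))) Z-acceptable
      ; others-uninteresting = λ d d∈U⁺ d∈Ew d≢a → ¬Interesting⇒Uninteresting {shiftℕ X a c} d∈Ew
          λ interesting → no-interesting d d∈U⁺ d∈Ew d≢a (shiftℕ X a c , embedding , interesting)
      }
      where
      embedding : emb M (shiftℕ X a c) ≡ shift M (emb M X) a c
      embedding = emb-shiftℕ-restrict c∈Ew c∈U⁻ a∈U⁺

    NoInterestingEdge : Vec ℤ.ℤ m → Set
    NoInterestingEdge s = ∀ d → UF⁺ M x d → ¬ InterestingZ M v s d

    module TwoEssentialExchanges {c a c' a'}
      (c≢c' : c ≢ c') (c≢a' : c ≢ a') (a≢c' : a ≢ c') (a≢a' : a ≢ a')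
      (E : EssentialExchange c a) (E' : EssentialExchange c' a') where
      open EssentialExchange E
      open EssentialExchange E' renaming
        (c∈U⁻ to c'∈U⁻; a∈U⁺ to a'∈U⁺; a∈Ew to a'∈Ew; c∈Ew to c'∈Ew; acceptable to acceptable';
         others-uninteresting to others-uninteresting')
      open TwoExchanges v (UF⁺-UF⁻-disjoint a∈U⁺ c∈U⁻) (UF⁺-UF⁻-disjoint a'∈U⁺ c'∈U⁻)
             c≢c' c≢a' a≢c' a≢a' (0<restrict c∈Ew c∈U⁻) (0<restrict c'∈Ew c'∈U⁻) acceptable acceptable'
             (others-uninteresting a' a'∈U⁺ a'∈Ew (≢-sym a≢a')) (others-uninteresting' a a∈U⁺ a∈Ew a≢a')

      u : Vec ℤ.ℤ m
      u = emb M X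

      y≡embY : shift M (shift M u a c) a' c' ≡ emb M Y
      y≡embY = trans (cong (λ z → shift M z a' c') (sym (emb-shiftℕ-restrict c∈Ew c∈U⁻ a∈U⁺)))
                     (sym emb-Y)

      y'≡embY : shift M (shift M u a' c') a c ≡ emb M Y
      y'≡embY = trans (cong (λ z → shift M z a c) (sym (emb-shiftℕ-restrict c'∈Ew c'∈U⁻ a'∈U⁺)))
                      (sym emb-Y')

      embY-no-interesting : NoInterestingEdge (emb M Y)
      embY-no-interesting d d∈U⁺ (Y₂ , Y₂≡Y , Y₂-interesting) =
        ¬Interesting-Y (UF⁺-UF⁻-disjoint d∈U⁺ c∈U⁻) (UF⁺-UF⁻-disjoint d∈U⁺ c'∈U⁻)
          (others-uninteresting d d∈U⁺ d∈Ew) (others-uninteresting' d d∈U⁺ d∈Ew)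
          (subst (λ W → Interesting M v W d) (emb-injective Y₂≡Y) Y₂-interesting)
        where
        d∈Ew : At v d
        d∈Ew = proj₁ Y₂-interesting

      y-acceptable : AcceptableZ M v (shift M (shift M u a c) a' c')
      y-acceptable = subst (AcceptableZ M v) (sym y≡embY) (Y , refl , Y-acceptable)

      y'-acceptable : AcceptableZ M v (shift M (shift M u a' c') a c)
      y'-acceptable = subst (AcceptableZ M v) (sym y'≡embY) (Y , refl , Y-acceptable)

      y-no-interesting : NoInterestingEdge (shift M (shift M u a c) a' c')
      y-no-interesting = subst NoInterestingEdge (sym y≡embY) embY-no-interesting

      y'-no-interesting : NoInterestingEdge (shift M (shift M u a' c') a c)
      y'-no-interesting = subst NoInterestingEdge (sym y'≡embY) embY-no-interesting

      z-essential : Essential M x w (shift M u a c) c' a'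
      z-essential =
        (c'∈Ew , a'∈Ew , c'∈U⁻ , a'∈U⁺ , y-acceptable) , λ d d∈U⁺ _ _ → y-no-interesting d d∈U⁺

      z'-essential : Essential M x w (shift M u a' c') c a
      z'-essential =
        (c∈Ew , a∈Ew , c∈U⁻ , a∈U⁺ , y'-acceptable) , λ d d∈U⁺ _ _ → y'-no-interesting d d∈U⁺

lemma3p7 : (M : Market) → let open Market M in
    (x xmax : Vec ℕ m) → Stable M x → IsGreatest M xmax → x ≢ xmax →
    (w : Fin nW) (c a c' a' : Fin m) → DisjointPairs M c a c' a' →
    Essential M x w (emb M (restrict (inj₁ w) x)) c a →
    Essential M x w (emb M (restrict (inj₁ w) x)) c' a' →
    let u = emb M (restrict (inj₁ w) x)
        z = shift M u a c
        z' = shift M u a' c'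
        y = shift M (shift M u a c) a' c'
    in (AcceptableZ M (inj₁ w) (shift M z a' c') × AcceptableZ M (inj₁ w) (shift M z' a c))
       × (∀ d → UF⁺ M x d → ¬ InterestingZ M (inj₁ w) y d)
       × (Essential M x w z c' a' × Essential M x w z' c a)
lemma3p7 M x _ _ _ _ w c a c' a' (c≢c' , c≢a' , a≢c' , a≢a') ess ess' =
  (y-acceptable , y'-acceptable) , y-no-interesting , (z-essential , z'-essential)
  where
  open TwoEssentialExchanges M x w c≢c' c≢a' a≢c' a≢a'
         (essential-exchange M x w ess) (essential-exchange M x w ess')
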